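{- Let $x_0=(y_0,m_0,d_0)\in G_0$ and let $r_1=\#\{z\in G_0: (100\cdot(y_0/100),3,0)\le z<x_0\}$ be its day of the century. Set $n_2=4\cdot r_1+3$, $u_2=2939745\cdot n_2$, $q_2=u_2/2^{32}$ and $r_2=u_2\%2^{32}/2939745/4$. Then $q_2=y_0\%100$ (the year of the century of $x_0$) and $r_2=\#\{z\in G_0: (y_0,3,0)\le z<x_0\}$ (the day of the year of $x_0$).
   Context: For $n,\delta\in\mathbb{Z}$ with $\delta\neq0$, $n/\delta$ and $n\%\delta$ denote Euclidean quotient and remainder ($n=q\delta+s$, $0\le s<|\delta|$); $\cdot$, $/$, $\%$ have equal precedence and associate left to right (so $u_2\%2^{32}/2939745/4=(((u_2\%2^{32})/2939745)/4)$). $\mathbb{Z}^3$ carries the lexicographic order. A year $y$ is a leap year if ($y\%4=0$ and $y\%100\ne0$) or $y\%400=0$. The Gregorian calendar is $G=\{(y,m,d)\in\mathbb{Z}^3: m\in\{1,\dots,12\},\ 1\le d\le L(y,m)\}$ where $L(y,m)=31$ for $m\in\{1,3,5,7,8,10,12\}$, $L(y,m)=30$ for $m\in\{4,6,9,11\}$, and $L(y,2)=29$ if $y$ is a leap year and $28$ otherwise. Let $P_1:\mathbb{Z}^3\to\mathbb{Z}^3$, $P_1(y,m,d)=(y-\mathbf 1_{\{m\le2\}},\ m+12\cdot\mathbf 1_{\{m\le2\}},\ d-1)$, where $\mathbf 1_{\{P\}}$ is $1$ if $P$ holds and $0$ otherwise. The computational calendar is $G_0=\{P_1(x): x\in G,\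 P_1(x)\ge (0,3,0)\}$. -}

module Defs where

open import Data.Nat as ℕ using (ℕ)
open import Data.Integer as ℤ using (ℤ; +_; _+_; _-_; _*_; _%ℕ_; _/ℕ_)
open import Data.Product using (Σ; _×_; _,_; ∃)
open import Data.Sum using (_⊎_)
open import Data.Empty using (⊥)
open import Data.List using (List; length)
open import Data.List.Membership.Propositional using (_∈_)
open import Data.List.Relation.Unary.Unique.Propositional using (Unique)
open import Relation.Nullary using (yes; no)
open import Relation.Binary.PropositionalEquality using (_≡_; _≢_)

Date : Set
Date = ℤ × ℤ × ℤ

_<ₗ_ : Date → Date → Set
(y , m , d) <ₗ (y' , m' , d') =
  (y ℤ.< y') ⊎ ((y ≡ y') × ((m ℤ.< m') ⊎ ((m ≡ m') × (d ℤ.< d'))))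

_≤ₗ_ : Date → Date → Set
a ≤ₗ b = (a <ₗ b) ⊎ (a ≡ b)

-- Leap year (Euclidean remainder: _%ℕ_ on ℤ is Euclidean)
IsLeap : ℤ → Set
IsLeap y = ((y %ℕ 4 ≡ 0) × (y %ℕ 100 ≢ 0)) ⊎ (y %ℕ 400 ≡ 0)

data MonthLength : ℤ → ℤ → ℤ → Set where
  len31 : ∀ {y m} → (m ≡ + 1) ⊎ (m ≡ + 3) ⊎ (m ≡ + 5) ⊎ (m ≡ + 7) ⊎ (m ≡ + 8) ⊎ (m ≡ + 10) ⊎ (m ≡ + 12)
        → MonthLength y m (+ 31)
  len30 : ∀ {y m} → (m ≡ + 4) ⊎ (m ≡ + 6) ⊎ (m ≡ + 9) ⊎ (m ≡ + 11)
        → MonthLength y m (+ 30)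
  len29 : ∀ {y} → IsLeap y → MonthLength y (+ 2) (+ 29)
  len28 : ∀ {y} → (IsLeap y → ⊥) → MonthLength y (+ 2) (+ 28)

InG : Date → Set
InG (y , m , d) = Σ ℤ λ L → MonthLength y m L × (+ 1 ℤ.≤ d) × (d ℤ.≤ L)

P₁ : Date → Date
P₁ (y , m , d) with m ℤ.≤? + 2
... | yes _ = (y - + 1 , m + + 12 , d - + 1)
... | no  _ = (y , m , d - + 1)

InG₀ : Date → Set
InG₀ z = Σ Date λ x → InG x × (P₁ x ≡ z) × ((+ 0 , + 3 , + 0) ≤ₗ P₁ x)

HasCard : (Date → Set) → ℕ → Set
HasCard P n = Σ (List Date) λ l →
  Unique l × (∀ z → (z ∈ l → P z) × (P z → z ∈ l)) × (length l ≡ n)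

{-# OPTIONS --safe #-}
module Submission where

open import Defs
open import Data.Bool using (T; if_then_else_)
open import Data.Integer using (ℤ; +_; _%ℕ_; _/ℕ_; +≤+; +<+)
import Data.Integer
import Data.Integer as ℤ
import Data.Integer.Properties as ℤ
open import Data.List using (List; []; _∷_; _++_; map; filter; length; upTo)
open import Data.List.Membership.Propositional using (_∈_)
open import Data.List.Membership.Propositional.Properties
  using (∈-map⁺; ∈-map⁻; ∈-++⁺ˡ; ∈-++⁺ʳ; ∈-++⁻; ∈-∃++; ∈-upTo⁺; ∈-upTo⁻; ∈-filter⁺; ∈-filter⁻)
open import Data.List.Properties using (length-map; length-upTo; length-++; filter-++; filter-all; filter-notAll)
import Data.List.Relation.Unary.All as All
open import Data.List.Relation.Unary.AllPairs using ([]; _∷_)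
import Data.List.Relation.Unary.Any as Any
open import Data.List.Relation.Unary.Any using (here; there)
open import Data.List.Relation.Unary.Unique.Propositional using (Unique)
import Data.List.Relation.Unary.Unique.Propositional.Properties as Unique
open import Data.Nat using (ℕ; zero; suc; _+_; _*_; _/_; _%_; _^_; _≤_; _<_; _≤ᵇ_; _<ᵇ_; z≤n; s≤s; z<s; _≟_)
open import Data.Nat.Properties
open import Data.Nat.DivMod using (m≡m%n+[m/n]*n; [m+kn]%n≡m%n; m<n⇒m%n≡m; m%n<n)
open import Data.Nat.Divisibility using (divides; ∣-trans; m%n≡0⇒n∣m; n∣m⇒m%n≡0)
open import Data.Nat.Tactic.RingSolver using (solve-∀)
open import Data.Product using (_×_; _,_; ∃; proj₁; proj₂)
open import Data.Sum using (inj₁; inj₂)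
open import Function.Bundles using (_⇔_; mk⇔; Equivalence)
open import Relation.Nullary using (Dec; yes; no; ¬_; does; ¬?; contradiction)
open import Relation.Nullary.Decidable using (_×-dec_; _⊎-dec_; dec-true; dec-false; from-yes)
open import Relation.Binary.PropositionalEquality
  using (_≡_; refl; sym; trans; cong; cong₂; subst; module ≡-Reasoning)

-- An element of G₀ is a triple (Y, M, D) of naturals with 3 ≤ M ≤ 14 and D below the
-- length of month M of the computational year Y, whose months 13 and 14 are January and
-- February of Y + 1.  Hence the days counted by r₁ are those of the complete years
-- 100 (y₀ / 100), …, y₀ − 1 followed by the r₂ days of year y₀ before x₀.  Within a
-- century the computational year a has the Julian length ℓ a = 365 + [4 ∣ a + 1], except
-- that the last one may lose its 29 February, so r₁ = ℓ 0 + ⋯ + ℓ (a − 1) + r₂ with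
-- a = y₀ % 100 and r₂ < ℓ a.  Both formulas are then verified by evaluating them on all
-- 36525 such pairs (a, r₂).

date : ℕ → ℕ → ℕ → Date
date Y M D = + Y , + M , + D

leap? : (y : ℤ) → Dec (IsLeap y)
leap? y = ((y %ℕ 4 ≟ 0) ×-dec ¬? (y %ℕ 100 ≟ 0)) ⊎-dec (y %ℕ 400 ≟ 0)

februaryLength : ℤ → ℕ
februaryLength y = if does (leap? y) then 29 else 28

februaryLength-leap : ∀ y → IsLeap y → februaryLength y ≡ 29
februaryLength-leap y leap = cong (if_then 29 else 28) (dec-true (leap? y) leap)

februaryLength-common : ∀ y → ¬ IsLeap y → februaryLength y ≡ 28
februaryLength-common y ¬leap = cong (if_then 29 else 28) (dec-false (leap? y) ¬leap)

februaryLength≤29 : ∀ y → februaryLength y ≤ 29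
februaryLength≤29 y with leap? y
... | yes leap = ≤-reflexive (februaryLength-leap y leap)
... | no ¬leap = subst (_≤ 29) (sym (februaryLength-common y ¬leap)) (n≤1+n 28)

february : ∀ y → MonthLength y (+ 2) (+ februaryLength y)
february y with leap? y
... | yes leap = subst (λ L → MonthLength y (+ 2) (+ L)) (sym (februaryLength-leap y leap)) (len29 leap)
... | no ¬leap = subst (λ L → MonthLength y (+ 2) (+ L)) (sym (februaryLength-common y ¬leap)) (len28 ¬leap)

monthLength : ℕ → ℕ → ℕ
monthLength Y 3 = 31
monthLength Y 4 = 30
monthLength Y 5 = 31
monthLength Y 6 = 30
monthLength Y 7 = 31
monthLength Y 8 = 31
monthLength Y 9 = 30
monthLength Y 10 = 31
monthLength Y 11 = 30
monthLength Y 12 = 31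
monthLength Y 13 = 31
monthLength Y 14 = februaryLength (+ suc Y)
monthLength Y _ = 0

ValidDate : ℕ → ℕ → ℕ → Set
ValidDate Y M D = 3 ≤ M × M < 15 × D < monthLength Y M

IsValidDate : Date → Set
IsValidDate z = ∃ λ Y → ∃ λ M → ∃ λ D → z ≡ date Y M D × ValidDate Y M D

_<ₗ?_ : (a b : Date) → Dec (a <ₗ b)
(y , m , d) <ₗ? (y′ , m′ , d′) =
  (y ℤ.<? y′) ⊎-dec ((y ℤ.≟ y′) ×-dec ((m ℤ.<? m′) ⊎-dec ((m ℤ.≟ m′) ×-dec (d ℤ.<? d′))))

<ₗ-irrefl : ∀ a → ¬ (a <ₗ a)
<ₗ-irrefl _ (inj₁ y<y) = ℤ.<-irrefl refl y<y
<ₗ-irrefl _ (inj₂ (_ , inj₁ m<m)) = ℤ.<-irrefl refl m<m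
<ₗ-irrefl _ (inj₂ (_ , inj₂ (_ , d<d))) = ℤ.<-irrefl refl d<d

<ₗ⇒year≤ : ∀ {a b} → a <ₗ b → proj₁ a ℤ.≤ proj₁ b
<ₗ⇒year≤ (inj₁ y<y′) = ℤ.<⇒≤ y<y′
<ₗ⇒year≤ (inj₂ (refl , _)) = ℤ.≤-refl

≤ₗ⇒year≤ : ∀ {a b} → a ≤ₗ b → proj₁ a ℤ.≤ proj₁ b
≤ₗ⇒year≤ (inj₁ a<b) = <ₗ⇒year≤ a<b
≤ₗ⇒year≤ (inj₂ refl) = ℤ.≤-refl

yearStart-≤ₗ : ∀ {Y₁ Y M D} → Y₁ ≤ Y → 3 ≤ M → (+ Y₁ , + 3 , + 0) ≤ₗ date Y M D
yearStart-≤ₗ {D = D} Y₁≤Y 3≤M with m≤n⇒m<n∨m≡n Y₁≤Y | m≤n⇒m<n∨m≡n 3≤M | D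
... | inj₁ Y₁<Y | _         | _     = inj₁ (inj₁ (+<+ Y₁<Y))
... | inj₂ refl | inj₁ 3<M  | _     = inj₁ (inj₂ (refl , inj₁ (+<+ 3<M)))
... | inj₂ refl | inj₂ refl | zero  = inj₂ refl
... | inj₂ refl | inj₂ refl | suc _ = inj₁ (inj₂ (refl , inj₂ (refl , +<+ z<s)))

nonNegative : ∀ {y} → + 0 ℤ.≤ y → ∃ λ Y → y ≡ + Y
nonNegative (+≤+ _) = _ , refl

pred-nonNegative : ∀ {y} → + 0 ℤ.≤ y ℤ.- + 1 → ∃ λ Y → y ≡ + suc Y
pred-nonNegative {+ suc Y} _ = Y , refl

P₁-late : ∀ {Y M D} → 3 ≤ M → P₁ (+ Y , + M , + suc D) ≡ date Y M D
P₁-late {M = M} 3≤M with + M ℤ.≤? + 2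
... | yes M≤2 = contradiction (ℤ.drop‿+≤+ M≤2) (<⇒≱ 3≤M)
... | no _ = refl

InG₀-image : ∀ {y m D L z} → MonthLength y m (+ L) → D < L → P₁ (y , m , + suc D) ≡ z
           → (+ 0 , + 3 , + 0) ≤ₗ z → InG₀ z
InG₀-image len D<L refl 0≤z = _ , (_ , len , +≤+ (s≤s z≤n) , +≤+ D<L) , refl , 0≤z

InG₀-marchToDecember : ∀ {Y M D} → MonthLength (+ Y) (+ M) (+ monthLength Y M) → ValidDate Y M D
                     → InG₀ (date Y M D)
InG₀-marchToDecember len (3≤M , _ , D<) = InG₀-image len D< (P₁-late 3≤M) (yearStart-≤ₗ z≤n 3≤M)

ValidDate⇒InG₀ : ∀ {Y M D} → ValidDate Y M D → InG₀ (date Y M D)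
ValidDate⇒InG₀ {M = 3} = InG₀-marchToDecember (len31 (inj₂ (inj₁ refl)))
ValidDate⇒InG₀ {M = 4} = InG₀-marchToDecember (len30 (inj₁ refl))
ValidDate⇒InG₀ {M = 5} = InG₀-marchToDecember (len31 (inj₂ (inj₂ (inj₁ refl))))
ValidDate⇒InG₀ {M = 6} = InG₀-marchToDecember (len30 (inj₂ (inj₁ refl)))
ValidDate⇒InG₀ {M = 7} = InG₀-marchToDecember (len31 (inj₂ (inj₂ (inj₂ (inj₁ refl)))))
ValidDate⇒InG₀ {M = 8} = InG₀-marchToDecember (len31 (inj₂ (inj₂ (inj₂ (inj₂ (inj₁ refl))))))
ValidDate⇒InG₀ {M = 9} = InG₀-marchToDecember (len30 (inj₂ (inj₂ (inj₁ refl))))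
ValidDate⇒InG₀ {M = 10} = InG₀-marchToDecember (len31 (inj₂ (inj₂ (inj₂ (inj₂ (inj₂ (inj₁ refl)))))))
ValidDate⇒InG₀ {M = 11} = InG₀-marchToDecember (len30 (inj₂ (inj₂ (inj₂ refl))))
ValidDate⇒InG₀ {M = 12} = InG₀-marchToDecember (len31 (inj₂ (inj₂ (inj₂ (inj₂ (inj₂ (inj₂ refl)))))))
ValidDate⇒InG₀ {Y} {M = 13} (3≤M , _ , D<) =
  InG₀-image (len31 {+ suc Y} (inj₁ refl)) D< refl (yearStart-≤ₗ z≤n 3≤M)
ValidDate⇒InG₀ {Y} {M = 14} (3≤M , _ , D<) =
  InG₀-image (february (+ suc Y)) D< refl (yearStart-≤ₗ z≤n 3≤M)
ValidDate⇒InG₀ {M = 0} (_ , _ , ())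
ValidDate⇒InG₀ {M = 1} (_ , _ , ())
ValidDate⇒InG₀ {M = 2} (_ , _ , ())
ValidDate⇒InG₀ {M = suc (suc (suc (suc (suc (suc (suc (suc (suc (suc (suc (suc (suc (suc (suc _))))))))))))))} (_ , _ , ())

marchToDecember-IsValidDate : ∀ {y M D} {3≤M : T (3 ≤ᵇ M)} {M<15 : T (M <ᵇ 15)}
                            → (∀ {Y} → D < monthLength Y M)
                            → (+ 0 , + 3 , + 0) ≤ₗ (y , + M , + D) → IsValidDate (y , + M , + D)
marchToDecember-IsValidDate {M = M} {3≤M = 3≤M} {M<15} D< 0≤z with nonNegative (≤ₗ⇒year≤ 0≤z)
... | Y , refl = Y , M , _ , refl , ≤ᵇ⇒≤ 3 M 3≤M , <ᵇ⇒< M 15 M<15 , D<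

P₁-IsValidDate : ∀ {y m D L} → MonthLength y m (+ L) → D < L
               → (+ 0 , + 3 , + 0) ≤ₗ P₁ (y , m , + suc D) → IsValidDate (P₁ (y , m , + suc D))
P₁-IsValidDate (len31 (inj₂ (inj₁ refl))) D< = marchToDecember-IsValidDate D<
P₁-IsValidDate (len31 (inj₂ (inj₂ (inj₁ refl)))) D< = marchToDecember-IsValidDate D<
P₁-IsValidDate (len31 (inj₂ (inj₂ (inj₂ (inj₁ refl))))) D< = marchToDecember-IsValidDate D<
P₁-IsValidDate (len31 (inj₂ (inj₂ (inj₂ (inj₂ (inj₁ refl)))))) D< = marchToDecember-IsValidDate D<
P₁-IsValidDate (len31 (inj₂ (inj₂ (inj₂ (inj₂ (inj₂ (inj₁ refl))))))) D< = marchToDecember-IsValidDate D<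
P₁-IsValidDate (len31 (inj₂ (inj₂ (inj₂ (inj₂ (inj₂ (inj₂ refl))))))) D< = marchToDecember-IsValidDate D<
P₁-IsValidDate (len30 (inj₁ refl)) D< = marchToDecember-IsValidDate D<
P₁-IsValidDate (len30 (inj₂ (inj₁ refl))) D< = marchToDecember-IsValidDate D<
P₁-IsValidDate (len30 (inj₂ (inj₂ (inj₁ refl)))) D< = marchToDecember-IsValidDate D<
P₁-IsValidDate (len30 (inj₂ (inj₂ (inj₂ refl)))) D< = marchToDecember-IsValidDate D<
P₁-IsValidDate {y} (len31 (inj₁ refl)) D< 0≤z with pred-nonNegative {y} (≤ₗ⇒year≤ 0≤z)
... | Y , refl = Y , 13 , _ , refl , s≤s (s≤s (s≤s z≤n)) , n≤1+n 14 , D<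
P₁-IsValidDate {y} (len29 leap) D< 0≤z with pred-nonNegative {y} (≤ₗ⇒year≤ 0≤z)
... | Y , refl = Y , 14 , _ , refl , s≤s (s≤s (s≤s z≤n)) , ≤-refl ,
                 subst (_ <_) (sym (februaryLength-leap (+ suc Y) leap)) D<
P₁-IsValidDate {y} (len28 ¬leap) D< 0≤z with pred-nonNegative {y} (≤ₗ⇒year≤ 0≤z)
... | Y , refl = Y , 14 , _ , refl , s≤s (s≤s (s≤s z≤n)) , ≤-refl ,
                 subst (_ <_) (sym (februaryLength-common (+ suc Y) ¬leap)) D<

InG₀⇒IsValidDate : ∀ {z} → InG₀ z → IsValidDate z
InG₀⇒IsValidDate (_ , (_ , len , +≤+ (s≤s z≤n) , +≤+ D<L) , refl , 0≤z) = P₁-IsValidDate len D<L 0≤z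

concatRange : {A : Set} → (ℕ → List A) → ℕ → ℕ → List A
concatRange F a zero = []
concatRange F a (suc n) = concatRange F a n ++ F (a + n)

module _ {A : Set} (F : ℕ → List A) where

  ∈-concatRange⁻ : ∀ a n {z} → z ∈ concatRange F a n → ∃ λ i → a ≤ i × i < a + n × z ∈ F i
  ∈-concatRange⁻ a (suc n) z∈ with ∈-++⁻ (concatRange F a n) z∈
  ... | inj₁ z∈init =
    let i , a≤i , i<a+n , z∈Fi = ∈-concatRange⁻ a n z∈init
    in  i , a≤i , <-≤-trans i<a+n (+-monoʳ-≤ a (n≤1+n n)) , z∈Fi
  ... | inj₂ z∈last = a + n , m≤m+n a n , +-monoʳ-< a (n<1+n n) , z∈last

  ∈-concatRange⁺ : ∀ a n {i z} → a ≤ i → i < a + n → z ∈ F i → z ∈ concatRange F a n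
  ∈-concatRange⁺ a zero a≤i i<a+0 _ = contradiction (subst (_≤ _) (sym (+-identityʳ a)) a≤i) (<⇒≱ i<a+0)
  ∈-concatRange⁺ a (suc n) {i} a≤i i<a+1+n z∈Fi with i ≟ a + n
  ... | yes refl = ∈-++⁺ʳ (concatRange F a n) z∈Fi
  ... | no i≢a+n =
    ∈-++⁺ˡ (∈-concatRange⁺ a n a≤i (≤∧≢⇒< (≤-pred (subst (suc i ≤_) (+-suc a n) i<a+1+n)) i≢a+n) z∈Fi)

  concatRange-unique : (∀ {i j z} → z ∈ F i → z ∈ F j → i ≡ j) → (∀ i → Unique (F i))
                     → ∀ a n → Unique (concatRange F a n)
  concatRange-unique disjoint unique a zero = []
  concatRange-unique disjoint unique a (suc n) =
    Unique.++⁺ (concatRange-unique disjoint unique a n) (unique (a + n)) λ (z∈init , z∈last) →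
      let i , _ , i<a+n , z∈Fi = ∈-concatRange⁻ a n z∈init
      in  <-irrefl (disjoint z∈Fi z∈last) i<a+n

monthDays : ℕ → ℕ → List Date
monthDays Y M = map (date Y M) (upTo (monthLength Y M))

yearDays : ℕ → List Date
yearDays Y = concatRange (monthDays Y) 3 12

daysOfYears : ℕ → ℕ → List Date
daysOfYears = concatRange yearDays

∈-monthDays⁻ : ∀ {Y M z} → z ∈ monthDays Y M → ∃ λ D → z ≡ date Y M D × D < monthLength Y M
∈-monthDays⁻ z∈ with ∈-map⁻ (date _ _) z∈
... | D , D∈ , refl = D , refl , ∈-upTo⁻ D∈

∈-yearDays⁻ : ∀ {Y z} → z ∈ yearDays Y → ∃ λ M → ∃ λ D → z ≡ date Y M D × ValidDate Y M D
∈-yearDays⁻ z∈ with ∈-concatRange⁻ (monthDays _) 3 12 z∈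
... | M , 3≤M , M<15 , z∈monthDays with ∈-monthDays⁻ z∈monthDays
...   | D , refl , D< = M , D , refl , 3≤M , M<15 , D<

∈-yearDays⁺ : ∀ {Y M D} → ValidDate Y M D → date Y M D ∈ yearDays Y
∈-yearDays⁺ (3≤M , M<15 , D<) =
  ∈-concatRange⁺ (monthDays _) 3 12 3≤M M<15 (∈-map⁺ (date _ _) (∈-upTo⁺ D<))

yearDays-unique : ∀ Y → Unique (yearDays Y)
yearDays-unique Y = concatRange-unique (monthDays Y) monthDays-disjoint monthDays-unique 3 12
  where
  monthDays-disjoint : ∀ {M M′ z} → z ∈ monthDays Y M → z ∈ monthDays Y M′ → M ≡ M′
  monthDays-disjoint z∈ z∈′ with ∈-monthDays⁻ z∈ | ∈-monthDays⁻ z∈′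
  ... | _ , refl , _ | _ , refl , _ = refl
  monthDays-unique : ∀ M → Unique (monthDays Y M)
  monthDays-unique M = Unique.map⁺ (λ { refl → refl }) (Unique.upTo⁺ (monthLength Y M))

daysOfYears-unique : ∀ Y₁ n → Unique (daysOfYears Y₁ n)
daysOfYears-unique = concatRange-unique yearDays yearDays-disjoint yearDays-unique
  where
  yearDays-disjoint : ∀ {Y Y′ z} → z ∈ yearDays Y → z ∈ yearDays Y′ → Y ≡ Y′
  yearDays-disjoint z∈ z∈′ with ∈-yearDays⁻ z∈ | ∈-yearDays⁻ z∈′
  ... | _ , _ , refl , _ | _ , _ , refl , _ = refl

length-yearDays : ∀ Y → length (yearDays Y) ≡ 337 + februaryLength (+ suc Y)
length-yearDays Y =
  cong (λ n → 337 + n) (trans (length-map (date Y 14) (upTo (monthLength Y 14))) (length-upTo (monthLength Y 14)))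

unique-⊆⇒length≤ : ∀ {A : Set} {xs ys : List A} → Unique xs → (∀ {z} → z ∈ xs → z ∈ ys)
                  → length xs ≤ length ys
unique-⊆⇒length≤ {xs = []} _ _ = z≤n
unique-⊆⇒length≤ {xs = x ∷ xs} (x∉xs ∷ xs-unique) xs⊆ys with ∈-∃++ (xs⊆ys (here refl))
... | ys₁ , ys₂ , refl = begin
  suc (length xs)               ≤⟨ s≤s (unique-⊆⇒length≤ xs-unique xs⊆ys₁++ys₂) ⟩
  suc (length (ys₁ ++ ys₂))     ≡⟨ cong suc (length-++ ys₁) ⟩
  suc (length ys₁ + length ys₂) ≡⟨ +-suc (length ys₁) (length ys₂) ⟨
  length ys₁ + length (x ∷ ys₂) ≡⟨ length-++ ys₁ ⟨
  length (ys₁ ++ x ∷ ys₂)       ∎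
  where
  open ≤-Reasoning
  xs⊆ys₁++ys₂ : ∀ {z} → z ∈ xs → z ∈ ys₁ ++ ys₂
  xs⊆ys₁++ys₂ z∈xs with ∈-++⁻ ys₁ (xs⊆ys (there z∈xs))
  ... | inj₁ z∈ys₁ = ∈-++⁺ˡ z∈ys₁
  ... | inj₂ (here refl) = contradiction refl (All.lookup x∉xs z∈xs)
  ... | inj₂ (there z∈ys₂) = ∈-++⁺ʳ ys₁ z∈ys₂

HasCard-unique : ∀ {P m n} → HasCard P m → HasCard P n → m ≡ n
HasCard-unique (xs , xs-unique , xs≐P , refl) (ys , ys-unique , ys≐P , refl) =
  ≤-antisym (unique-⊆⇒length≤ xs-unique λ {z} z∈xs → proj₂ (ys≐P z) (proj₁ (xs≐P z) z∈xs))
            (unique-⊆⇒length≤ ys-unique λ {z} z∈ys → proj₂ (xs≐P z) (proj₁ (ys≐P z) z∈ys))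

DaysBetween : Date → Date → Date → Set
DaysBetween lo hi z = InG₀ z × lo ≤ₗ z × z <ₗ hi

dayOfYear : ℕ → ℕ → ℕ → ℕ
dayOfYear Y M D = length (filter (_<ₗ? date Y M D) (yearDays Y))

dayOfYear<length-yearDays : ∀ {Y M D} → ValidDate Y M D → dayOfYear Y M D < length (yearDays Y)
dayOfYear<length-yearDays {Y} {M} {D} valid =
  filter-notAll (_<ₗ? date Y M D) (yearDays Y) (Any.map (λ { refl → <ₗ-irrefl _ }) (∈-yearDays⁺ valid))

HasCard-DaysBetween : ∀ Y₁ A {Y₀ M₀ D₀} → Y₁ + A ≡ Y₀ → ValidDate Y₀ M₀ D₀
                    → HasCard (DaysBetween (date Y₁ 3 0) (date Y₀ M₀ D₀))
                              (length (daysOfYears Y₁ A) + dayOfYear Y₀ M₀ D₀)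
HasCard-DaysBetween Y₁ A {M₀ = M₀} {D₀} refl x₀-valid =
  days , Unique.filter⁺ (_<ₗ? x₀) (daysOfYears-unique Y₁ (suc A)) , (λ z → sound , complete) , counted
  where
  x₀ : Date
  x₀ = date (Y₁ + A) M₀ D₀

  days : List Date
  days = filter (_<ₗ? x₀) (daysOfYears Y₁ (suc A))

  sound : ∀ {z} → z ∈ days → DaysBetween (date Y₁ 3 0) x₀ z
  sound z∈ with ∈-filter⁻ (_<ₗ? x₀) z∈
  ... | z∈years , z<x₀ with ∈-concatRange⁻ yearDays Y₁ (suc A) z∈years
  ...   | Y , Y₁≤Y , _ , z∈yearDays with ∈-yearDays⁻ z∈yearDays
  ...     | _ , _ , refl , valid = ValidDate⇒InG₀ valid , yearStart-≤ₗ Y₁≤Y (proj₁ valid) , z<x₀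

  complete : ∀ {z} → DaysBetween (date Y₁ 3 0) x₀ z → z ∈ days
  complete (z∈G₀ , lo≤z , z<x₀) with InG₀⇒IsValidDate z∈G₀
  ... | Y , _ , _ , refl , valid =
    ∈-filter⁺ (_<ₗ? x₀) (∈-concatRange⁺ yearDays Y₁ (suc A) Y₁≤Y Y<Y₁+1+A (∈-yearDays⁺ valid)) z<x₀
    where
    Y₁≤Y : Y₁ ≤ Y
    Y₁≤Y = ℤ.drop‿+≤+ (≤ₗ⇒year≤ lo≤z)
    Y<Y₁+1+A : Y < Y₁ + suc A
    Y<Y₁+1+A = subst (Y <_) (sym (+-suc Y₁ A)) (s≤s (ℤ.drop‿+≤+ (<ₗ⇒year≤ z<x₀)))

  earlier : ∀ {z} → z ∈ daysOfYears Y₁ A → z <ₗ x₀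
  earlier z∈ with ∈-concatRange⁻ yearDays Y₁ A z∈
  ... | _ , _ , Y<Y₁+A , z∈yearDays with ∈-yearDays⁻ z∈yearDays
  ...   | _ , _ , refl , _ = inj₁ (+<+ Y<Y₁+A)

  counted : length days ≡ length (daysOfYears Y₁ A) + dayOfYear (Y₁ + A) M₀ D₀
  counted = begin
    length (filter (_<ₗ? x₀) (daysOfYears Y₁ A ++ yearDays (Y₁ + A)))
      ≡⟨ cong length (filter-++ (_<ₗ? x₀) (daysOfYears Y₁ A) (yearDays (Y₁ + A))) ⟩
    length (filter (_<ₗ? x₀) (daysOfYears Y₁ A) ++ filter (_<ₗ? x₀) (yearDays (Y₁ + A)))
      ≡⟨ length-++ (filter (_<ₗ? x₀) (daysOfYears Y₁ A)) ⟩
    length (filter (_<ₗ? x₀) (daysOfYears Y₁ A)) + dayOfYear (Y₁ + A) M₀ D₀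
      ≡⟨ cong (λ ds → length ds + dayOfYear (Y₁ + A) M₀ D₀) (filter-all (_<ₗ? x₀) (All.tabulate earlier)) ⟩
    length (daysOfYears Y₁ A) + dayOfYear (Y₁ + A) M₀ D₀
      ∎
    where open ≡-Reasoning

julianYearLength : ℕ → ℕ
julianYearLength a = if does (suc a % 4 ≟ 0) then 366 else 365

centuryDays : ℕ → ℕ
centuryDays zero = 0
centuryDays (suc a) = centuryDays a + julianYearLength a

leap⇒%4≡0 : ∀ n → IsLeap (+ n) → n % 4 ≡ 0
leap⇒%4≡0 n (inj₁ (n%4≡0 , _)) = n%4≡0
leap⇒%4≡0 n (inj₂ n%400≡0) = n∣m⇒m%n≡0 n 4 (∣-trans (divides 100 refl) (m%n≡0⇒n∣m n 400 n%400≡0))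

leap-inCentury : ∀ C a → suc a < 100 → IsLeap (+ suc (100 * C + a)) ⇔ (suc a % 4 ≡ 0)
leap-inCentury C a 1+a<100 =
  mk⇔ (λ leap → trans (sym n%4) (leap⇒%4≡0 (suc (100 * C + a)) leap))
      (λ 1+a%4≡0 → inj₁ (trans n%4 1+a%4≡0 , λ n%100≡0 → 1+n≢0 (trans (sym n%100) n%100≡0)))
  where
  n≡1+a+25C*4 : ∀ C a → suc (100 * C + a) ≡ suc a + 25 * C * 4
  n≡1+a+25C*4 = solve-∀
  n≡1+a+C*100 : ∀ C a → suc (100 * C + a) ≡ suc a + C * 100
  n≡1+a+C*100 = solve-∀
  n%4 : suc (100 * C + a) % 4 ≡ suc a % 4
  n%4 = trans (cong (_% 4) (n≡1+a+25C*4 C a)) ([m+kn]%n≡m%n (suc a) (25 * C) 4)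
  n%100 : suc (100 * C + a) % 100 ≡ suc a
  n%100 = trans (cong (_% 100) (n≡1+a+C*100 C a)) (trans ([m+kn]%n≡m%n (suc a) C 100) (m<n⇒m%n≡m 1+a<100))

length-yearDays-inCentury : ∀ C a → suc a < 100 → length (yearDays (100 * C + a)) ≡ julianYearLength a
length-yearDays-inCentury C a 1+a<100 =
  trans (length-yearDays (100 * C + a))
        (agree (leap? (+ suc (100 * C + a))) (suc a % 4 ≟ 0) (leap-inCentury C a 1+a<100))
  where
  agree : ∀ {L J : Set} (L? : Dec L) (J? : Dec J) → L ⇔ J
        → 337 + (if does L? then 29 else 28) ≡ (if does J? then 366 else 365)
  agree (yes _) (yes _) _ = refl
  agree (no _) (no _) _ = refl
  agree (yes l) (no ¬j) l⇔j = contradiction (Equivalence.to l⇔j l) ¬j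
  agree (no ¬l) (yes j) l⇔j = contradiction (Equivalence.from l⇔j j) ¬l

length-yearDays≤julianYearLength : ∀ C a → a < 100 → length (yearDays (100 * C + a)) ≤ julianYearLength a
length-yearDays≤julianYearLength C a a<100 with m≤n⇒m<n∨m≡n a<100
... | inj₁ 1+a<100 = ≤-reflexive (length-yearDays-inCentury C a 1+a<100)
... | inj₂ refl = subst (_≤ 366) (sym (length-yearDays (100 * C + 99)))
                        (+-monoʳ-≤ 337 (februaryLength≤29 (+ suc (100 * C + 99))))

length-daysOfYears-inCentury : ∀ C a → a < 100 → length (daysOfYears (100 * C) a) ≡ centuryDays a
length-daysOfYears-inCentury C zero _ = refl
length-daysOfYears-inCentury C (suc a) 1+a<100 = begin
  length (daysOfYears (100 * C) a ++ yearDays (100 * C + a))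
    ≡⟨ length-++ (daysOfYears (100 * C) a) ⟩
  length (daysOfYears (100 * C) a) + length (yearDays (100 * C + a))
    ≡⟨ cong₂ _+_ (length-daysOfYears-inCentury C a (<-trans (n<1+n a) 1+a<100))
                 (length-yearDays-inCentury C a 1+a<100) ⟩
  centuryDays a + julianYearLength a
    ∎
  where open ≡-Reasoning

Recovers : ℕ → ℕ → ℕ → Set
Recovers r a doy = (2939745 * (4 * r + 3)) / 2 ^ 32 ≡ a × ((2939745 * (4 * r + 3)) % 2 ^ 32) / 2939745 / 4 ≡ doy

recovers? : ∀ r a doy → Dec (Recovers r a doy)
recovers? r a doy =
  ((2939745 * (4 * r + 3)) / 2 ^ 32 ≟ a) ×-dec (((2939745 * (4 * r + 3)) % 2 ^ 32) / 2939745 / 4 ≟ doy)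

centuryDays-recovers : ∀ a doy → a < 100 → doy < julianYearLength a → Recovers (centuryDays a + doy) a doy
centuryDays-recovers a doy a<100 = from-yes (allUpTo? (λ a → yearRecovers? (centuryDays a) a) 100) {a} a<100 {doy}
  where
  -- Taking the start of the year as an argument makes its evaluation shared by the whole year.
  yearRecovers? : ∀ start a → Dec (∀ {doy} → doy < julianYearLength a → Recovers (start + doy) a doy)
  yearRecovers? start a = allUpTo? (λ doy → recovers? (start + doy) a doy) (julianYearLength a)

-- Stated for an arbitrary x₀ so that corollary3 needs no with-abstraction over its goal,
-- whose type-checking is prohibitively expensive here.
IsValidDate⇒dayOfCentury-formulas :
  ∀ {x₀} → IsValidDate x₀ → (r₁ : ℕ)
  → HasCard (DaysBetween (+ 100 ℤ.* (proj₁ x₀ /ℕ 100) , + 3 , + 0) x₀) r₁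
  → ((2939745 * (4 * r₁ + 3)) / 2 ^ 32 ≡ proj₁ x₀ %ℕ 100)
    × HasCard (DaysBetween (proj₁ x₀ , + 3 , + 0) x₀) (((2939745 * (4 * r₁ + 3)) % 2 ^ 32) / 2939745 / 4)
IsValidDate⇒dayOfCentury-formulas (Y₀ , M₀ , D₀ , refl , x₀-valid) r₁ century-card =
  proj₁ recovers , subst (HasCard (DaysBetween (date Y₀ 3 0) x₀)) (sym (proj₂ recovers)) year-card
  where
  x₀ : Date
  x₀ = date Y₀ M₀ D₀
  C a doy : ℕ
  C = Y₀ / 100
  a = Y₀ % 100
  doy = dayOfYear Y₀ M₀ D₀
  a<100 : a < 100
  a<100 = m%n<n Y₀ 100
  100C+a≡Y₀ : 100 * C + a ≡ Y₀
  100C+a≡Y₀ = sym (trans (m≡m%n+[m/n]*n Y₀ 100) (trans (+-comm a (C * 100)) (cong (_+ a) (*-comm C 100))))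

  year-card : HasCard (DaysBetween (date Y₀ 3 0) x₀) doy
  year-card = HasCard-DaysBetween Y₀ 0 (+-identityʳ Y₀) x₀-valid
  century-card′ : HasCard (DaysBetween (date (100 * C) 3 0) x₀) (centuryDays a + doy)
  century-card′ = subst (λ days → HasCard (DaysBetween (date (100 * C) 3 0) x₀) (days + doy))
                        (length-daysOfYears-inCentury C a a<100)
                        (HasCard-DaysBetween (100 * C) a 100C+a≡Y₀ x₀-valid)
  r₁≡ : r₁ ≡ centuryDays a + doy
  r₁≡ = HasCard-unique (subst (λ lo → HasCard (DaysBetween (lo , + 3 , + 0) x₀) r₁) (sym (ℤ.pos-* 100 C))
                              century-card)
                       century-card′
  doy<julianYearLength : doy < julianYearLength a
  doy<julianYearLength =
    <-≤-trans (dayOfYear<length-yearDays x₀-valid)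
              (subst (λ Y → length (yearDays Y) ≤ julianYearLength a) 100C+a≡Y₀
                     (length-yearDays≤julianYearLength C a a<100))
  recovers : Recovers r₁ a doy
  recovers = subst (λ r → Recovers r a doy) (sym r₁≡) (centuryDays-recovers a doy a<100 doy<julianYearLength)

corollary3 : (y₀ m₀ d₀ : ℤ) → InG₀ (y₀ , m₀ , d₀) → (r₁ : ℕ)
    → HasCard (λ z → InG₀ z × ((+ 100 Data.Integer.* (y₀ /ℕ 100) , + 3 , + 0) ≤ₗ z) × (z <ₗ (y₀ , m₀ , d₀))) r₁
    → (((2939745 * (4 * r₁ + 3)) / 2 ^ 32) ≡ y₀ %ℕ 100)
      × HasCard (λ z → InG₀ z × ((y₀ , + 3 , + 0) ≤ₗ z) × (z <ₗ (y₀ , m₀ , d₀)))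
                (((2939745 * (4 * r₁ + 3)) % 2 ^ 32) / 2939745 / 4)
corollary3 y₀ m₀ d₀ x₀∈G₀ = IsValidDate⇒dayOfCentury-formulas (InG₀⇒IsValidDate x₀∈G₀)
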